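{- Let $P$ be a path of a tree $T$ and let $f$ be a broadcast on $T$. Let $\operatorname{Touch}(P)=\{v\in V_f^+: N_f(v)\cap V(P)\ne\varnothing\}$ and $\operatorname{Off}(P)=\{v\in V_f^+: N_f(v)\cap V(P)=\varnothing\}$, and set $\sigma_{1}=\sum_{v\in\operatorname{Touch}(P)}d(v,P)$ and $\sigma_{2}=\sum_{v\in\operatorname{Off}(P)}f(v)$. Then (i) $f$ covers at most $2\left(\sum_{v\in\operatorname{Touch}(P)}f(v)-\sigma_{1}\right)$ edges of $P$; (ii) if $f$ covers $b$ edges of $P$, then $\sigma(f)\geq\left\lceil \frac{b}{2}\right\rceil +\sigma_{1}+\sigma_{2}$.
   Context: A broadcast on a connected graph $G=(V,E)$ is a function $f:V\to\{0,1,\dots,\operatorname{diam}(G)\}$ with $f(v)\le e(v)$ (the eccentricity of $v$) for all $v$ if $|V|\ge 2$, and $f(v)=1$ if $V=\{v\}$; $\sigma(f)=\sum_v f(v)$ and $V_f^+=\{v:f(v)>0\}$. For $v\in V_f^+$, $N_f(v)=\{u:d(u,v)\le f(v)\}$ and $B_f(v)=\{u:d(u,v)=f(v)\}$. An edge $xy$ is covered by $f$ if for some $u\in V_f^+$, $x,y\in N_f(u)$ and at least one of $x,y$ is not in $B_f(u)$. For a vertex $v$, $d(v,P)$ is the distance from $v$ to the nearest vertex of $P$. -}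

module Defs where

open import Data.Nat using (ℕ; zero; suc; _+_; _*_; _∸_; _≤_; _<_; _⊔_; _⊓_; _≤ᵇ_; _<ᵇ_)
open import Data.Bool using (Bool; true; false; _∧_; _∨_; not; if_then_else_)
open import Data.Fin using (Fin; zero; suc; inject₁)
open import Data.Vec using (Vec; []; _∷_; lookup; foldr₁; toList)
open import Data.List using (List; allFin; map; filter; length; foldr)
open import Data.Nat.ListAction using (sum)
open import Data.Bool.ListAction using () renaming (any to anyL)
open import Data.Vec.Relation.Unary.Unique.Propositional using (Unique)
open import Data.Product using (Σ; _×_; _,_)
open import Relation.Binary.PropositionalEquality using (_≡_)
open import Relation.Nullary using (¬_)

record Graph (n : ℕ) : Set where
  field
    adj    : Fin n → Fin n → Bool
    sym    : ∀ u v → adj u v ≡ adj v u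
    irrefl : ∀ v → adj v v ≡ false
open Graph public

module _ {n : ℕ} (G : Graph n) where

  data Walk : Fin n → Fin n → ℕ → Set where
    stay : ∀ v → Walk v v 0
    step : ∀ {u v w k} → adj G u v ≡ true → Walk v w k → Walk u w (suc k)

  IsDist : Fin n → Fin n → ℕ → Set
  IsDist u v k = Walk u v k × (∀ m → Walk u v m → k ≤ m)

  Consecutive : ∀ {m} → Vec (Fin n) m → Set
  Consecutive [] = Data.Unit.⊤ where import Data.Unit
  Consecutive (x ∷ []) = Data.Unit.⊤ where import Data.Unit
  Consecutive (x ∷ y ∷ xs) = (adj G x y ≡ true) × Consecutive (y ∷ xs)

  IsPath : ∀ {m} → Vec (Fin n) (suc m) → Set
  IsPath p = Consecutive p × Unique p

  IsCycle : ∀ {m} → Vec (Fin n) (suc (suc (suc m))) → Set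
  IsCycle {m} c = IsPath c × (adj G (lookup c zero) (lookup c (Data.Fin.fromℕ (suc (suc m)))) ≡ true)
    where import Data.Fin

  Connected : Set
  Connected = ∀ u v → Σ ℕ (Walk u v)

  Acyclic : Set
  Acyclic = ∀ m (c : Vec (Fin n) (suc (suc (suc m)))) → ¬ IsCycle c

  IsTree : Set
  IsTree = Connected × Acyclic

Σv : ∀ {n} → (Fin n → ℕ) → ℕ
Σv g = sum (map g (allFin _))

maxv : ∀ {n} → (Fin n → ℕ) → ℕ
maxv g = foldr _⊔_ 0 (map g (allFin _))

module _ {n : ℕ} (d : Fin n → Fin n → ℕ) where

  ecc : Fin n → ℕ
  ecc v = maxv (d v)

  -- broadcast: f(v) ≤ e(v) if |V| ≥ 2, f(v) = 1 if |V| = 1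
  -- (f(v) ≤ diam(G) follows from f(v) ≤ e(v))
  IsBroadcast : (Fin n → ℕ) → Set
  IsBroadcast f = (2 ≤ n → ∀ v → f v ≤ ecc v) × (n ≡ 1 → ∀ v → f v ≡ 1)

  σ : (Fin n → ℕ) → ℕ
  σ f = Σv f

  module _ (f : Fin n → ℕ) where

    inVf+ : Fin n → Bool
    inVf+ v = 0 <ᵇ f v

    inN : Fin n → Fin n → Bool
    inN v u = d u v ≤ᵇ f v

    inB : Fin n → Fin n → Bool
    inB v u = (d u v ≤ᵇ f v) ∧ (f v ≤ᵇ d u v)

    coversEdge : Fin n → Fin n → Bool
    coversEdge x y = anyL (λ u → inVf+ u ∧ inN u x ∧ inN u y ∧ (not (inB u x) ∨ not (inB u y))) (allFin n)

    module _ {m : ℕ} (P : Vec (Fin n) (suc m)) where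

      distP : Fin n → ℕ
      distP v = foldr₁ _⊓_ (Data.Vec.map (d v) P) where import Data.Vec

      touch : Fin n → Bool
      touch v = inVf+ v ∧ anyL (inN v) (toList P)

      off : Fin n → Bool
      off v = inVf+ v ∧ not (anyL (inN v) (toList P))

      σ₁ : ℕ
      σ₁ = Σv (λ v → if touch v then distP v else 0)

      σ₂ : ℕ
      σ₂ = Σv (λ v → if off v then f v else 0)

      ΣTouch-f : ℕ
      ΣTouch-f = Σv (λ v → if touch v then f v else 0)

      -- number of edges p_i p_{i+1} (i < m) of P covered by f
      coveredEdges : ℕ
      coveredEdges = length (filter (λ i → Data.Bool._≟_ (coversEdge (lookup P (inject₁ i)) (lookup P (suc i))) true) (allFin m))
        where import Data.Bool

-- Rooting the tree T at a vertex u, the depths d(·,u) along any path of T change by exactly one at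
-- every step and never have a strict local maximum (a peak would give two parents of one vertex).
-- So along P they first decrease and then increase, and on each monotone stretch at most
-- f(u) − d(u,P) edges have both ends within distance f(u) of u. Every edge of P covered by f is
-- covered by some u ∈ Touch(P) in this way, which gives (i); (ii) follows from (i) since Touch(P)
-- and Off(P) are disjoint parts of V_f^+.
module Submission where

open import Defs hiding (sym)
open import Data.Nat using (ℕ; zero; suc; _+_; _*_; _∸_; _≤_; _≥_; _⊓_; _≤ᵇ_; ⌈_/2⌉; z≤n; s≤s)
open import Data.Nat.Properties
open import Data.Bool using (Bool; true; false; _∧_; _∨_; not; if_then_else_)
open import Data.Bool.Properties using (∧-assoc)
open import Data.Bool.ListAction using () renaming (any to anyL)
import Data.Bool as Bool
open import Data.Fin using (Fin; suc; inject₁; fromℕ)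
open import Data.Fin.Properties using () renaming (_≟_ to _≟ᶠ_)
open import Data.List using (List; []; _∷_; map; filter; length; tabulate; allFin)
open import Data.List.Properties using (map-cong; map-tabulate)
open import Data.Nat.ListAction using (sum)
open import Data.Vec using (Vec; []; _∷_; head; lookup; foldr₁; toList) renaming (map to vmap)
open import Data.Vec.Properties using () renaming (map-cong to vmap-cong)
open import Data.Vec.Relation.Unary.All using (All; []; _∷_)
open import Data.Vec.Relation.Unary.Any using (here; there)
open import Data.Vec.Relation.Unary.AllPairs using ([]; _∷_)
open import Data.Vec.Membership.Propositional using (_∈_)
open import Data.Product using (Σ; _×_; _,_; proj₁; proj₂)
open import Data.Sum using (_⊎_; inj₁; inj₂)
open import Data.Unit using (⊤; tt)
open import Data.Empty using (⊥-elim)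
open import Relation.Nullary using (¬_; yes; no)
open import Relation.Nullary.Reflects using (ofʸ; ofⁿ)
open import Relation.Binary.PropositionalEquality using (_≡_; _≢_; refl; sym; trans; cong; subst; module ≡-Reasoning)
open import Algebra.Properties.CommutativeSemigroup +-commutativeSemigroup using (interchange)

[_] : Bool → ℕ
[ b ] = if b then 1 else 0

[a∧b]≤[a] : ∀ a b → [ a ∧ b ] ≤ [ a ]
[a∧b]≤[a] true  true  = ≤-refl
[a∧b]≤[a] true  false = z≤n
[a∧b]≤[a] false b     = z≤n

[a∧b]≤[b] : ∀ a b → [ a ∧ b ] ≤ [ b ]
[a∧b]≤[b] true  b = ≤-refl
[a∧b]≤[b] false b = z≤n

[a∧b∧c]≤[a∧b] : ∀ a b c → [ a ∧ b ∧ c ] ≤ [ a ∧ b ]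
[a∧b∧c]≤[a∧b] a b c = subst (_≤ [ a ∧ b ]) (cong [_] (∧-assoc a b c)) ([a∧b]≤[a] (a ∧ b) c)

if-∧+if-∧-not≤ : ∀ a b x → (if a ∧ b then x else 0) + (if a ∧ not b then x else 0) ≤ x
if-∧+if-∧-not≤ false b     x = z≤n
if-∧+if-∧-not≤ true  true  x = ≤-reflexive (+-identityʳ x)
if-∧+if-∧-not≤ true  false x = ≤-refl

n≢2+n : ∀ {n} → n ≢ suc (suc n)
n≢2+n {n} e = m≢1+m+n n (trans e (cong suc (+-comm 1 n)))

m≤2*n⇒⌈m/2⌉≤n : ∀ {m n} → m ≤ 2 * n → ⌈ m /2⌉ ≤ n
m≤2*n⇒⌈m/2⌉≤n {m} {n} m≤2n = begin
  ⌈ m /2⌉       ≤⟨ ⌈n/2⌉-mono (subst (m ≤_) (cong (n +_) (+-identityʳ n)) m≤2n) ⟩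
  ⌈ n + n /2⌉   ≡⟨ sym (n≡⌈n+n/2⌉ n) ⟩
  n             ∎
  where open ≤-Reasoning

module _ {A : Set} where

  sum-map-mono : ∀ {g h : A → ℕ} xs → (∀ x → g x ≤ h x) → sum (map g xs) ≤ sum (map h xs)
  sum-map-mono []       g≤h = z≤n
  sum-map-mono (x ∷ xs) g≤h = +-mono-≤ (g≤h x) (sum-map-mono xs g≤h)

  sum-map-const0 : ∀ (xs : List A) → sum (map (λ _ → 0) xs) ≡ 0
  sum-map-const0 []       = refl
  sum-map-const0 (x ∷ xs) = sum-map-const0 xs

  sum-map-+ : ∀ (g h : A → ℕ) xs → sum (map (λ x → g x + h x) xs) ≡ sum (map g xs) + sum (map h xs)
  sum-map-+ g h []       = refl
  sum-map-+ g h (x ∷ xs) =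
    trans (cong (g x + h x +_) (sum-map-+ g h xs)) (interchange (g x) (h x) _ _)

  sum-map-∸ : ∀ (g h : A → ℕ) xs → (∀ x → h x ≤ g x) →
              sum (map (λ x → g x ∸ h x) xs) ≡ sum (map g xs) ∸ sum (map h xs)
  sum-map-∸ g h xs h≤g = begin
    S (λ x → g x ∸ h x)               ≡⟨ sym (m+n∸n≡m _ (S h)) ⟩
    S (λ x → g x ∸ h x) + S h ∸ S h   ≡⟨ cong (_∸ S h) (sym (sum-map-+ _ h xs)) ⟩
    S (λ x → g x ∸ h x + h x) ∸ S h   ≡⟨ cong (λ s → sum s ∸ S h) (map-cong (λ x → m∸n+n≡m (h≤g x)) xs) ⟩
    S g ∸ S h                         ∎
    where
    open ≡-Reasoning
    S : (A → ℕ) → ℕ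
    S k = sum (map k xs)

  sum-map-*ˡ : ∀ k (g : A → ℕ) xs → sum (map (λ x → k * g x) xs) ≡ k * sum (map g xs)
  sum-map-*ˡ k g []       = sym (*-zeroʳ k)
  sum-map-*ˡ k g (x ∷ xs) =
    trans (cong (k * g x +_) (sum-map-*ˡ k g xs)) (sym (*-distribˡ-+ k (g x) _))

  length-filter≡sum : ∀ (q : A → Bool) xs →
                      length (filter (λ x → q x Bool.≟ true) xs) ≡ sum (map (λ x → [ q x ]) xs)
  length-filter≡sum q []       = refl
  length-filter≡sum q (x ∷ xs) with q x
  ... | true  = cong suc (length-filter≡sum q xs)
  ... | false = length-filter≡sum q xs

  [any]≤sum : ∀ (q : A → Bool) xs → [ anyL q xs ] ≤ sum (map (λ x → [ q x ]) xs)
  [any]≤sum q []       = z≤n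
  [any]≤sum q (x ∷ xs) with q x
  ... | true  = s≤s z≤n
  ... | false = [any]≤sum q xs

edgeSum : ∀ {A : Set} {k} → (A → A → ℕ) → Vec A (suc k) → ℕ
edgeSum w (x ∷ [])     = 0
edgeSum w (x ∷ y ∷ xs) = w x y + edgeSum w (y ∷ xs)

module _ {A : Set} where

  sum-tabulate≡edgeSum : ∀ {k} (w : A → A → ℕ) (xs : Vec A (suc k)) →
    sum (tabulate (λ i → w (lookup xs (inject₁ i)) (lookup xs (suc i)))) ≡ edgeSum w xs
  sum-tabulate≡edgeSum w (x ∷ [])     = refl
  sum-tabulate≡edgeSum w (x ∷ y ∷ xs) = cong (w x y +_) (sum-tabulate≡edgeSum w (y ∷ xs))

  count≡edgeSum : ∀ {k} (q : A → A → Bool) (xs : Vec A (suc k)) →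
    length (filter (λ i → q (lookup xs (inject₁ i)) (lookup xs (suc i)) Bool.≟ true) (allFin k))
      ≡ edgeSum (λ x y → [ q x y ]) xs
  count≡edgeSum {k} q xs = begin
    length (filter (λ i → Q i Bool.≟ true) (allFin k))  ≡⟨ length-filter≡sum Q (allFin k) ⟩
    sum (map (λ i → [ Q i ]) (allFin k))               ≡⟨ cong sum (map-tabulate (λ i → i) (λ i → [ Q i ])) ⟩
    sum (tabulate (λ i → [ Q i ]))                     ≡⟨ sum-tabulate≡edgeSum (λ x y → [ q x y ]) xs ⟩
    edgeSum (λ x y → [ q x y ]) xs                     ∎
    where
    open ≡-Reasoning
    Q : Fin k → Bool
    Q i = q (lookup xs (inject₁ i)) (lookup xs (suc i))

  edgeSum-mono : ∀ {k} {w w′ : A → A → ℕ} (xs : Vec A (suc k)) →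
                 (∀ x y → w x y ≤ w′ x y) → edgeSum w xs ≤ edgeSum w′ xs
  edgeSum-mono (x ∷ [])     w≤w′ = z≤n
  edgeSum-mono (x ∷ y ∷ xs) w≤w′ = +-mono-≤ (w≤w′ x y) (edgeSum-mono (y ∷ xs) w≤w′)

  edgeSum-zero : ∀ {k} (xs : Vec A (suc k)) → edgeSum (λ _ _ → 0) xs ≡ 0
  edgeSum-zero (x ∷ [])     = refl
  edgeSum-zero (x ∷ y ∷ xs) = edgeSum-zero (y ∷ xs)

  edgeSum-map : ∀ {B : Set} {k} (w : B → B → ℕ) (g : A → B) (xs : Vec A (suc k)) →
                edgeSum w (vmap g xs) ≡ edgeSum (λ x y → w (g x) (g y)) xs
  edgeSum-map w g (x ∷ [])     = refl
  edgeSum-map w g (x ∷ y ∷ xs) = cong (w (g x) (g y) +_) (edgeSum-map w g (y ∷ xs))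

  edgeSum-sum : ∀ {B : Set} {k} (w : B → A → A → ℕ) (us : List B) (xs : Vec A (suc k)) →
    edgeSum (λ x y → sum (map (λ u → w u x y) us)) xs ≡ sum (map (λ u → edgeSum (w u) xs) us)
  edgeSum-sum w us (x ∷ [])     = sym (sum-map-const0 us)
  edgeSum-sum w us (x ∷ y ∷ xs) =
    trans (cong (_ +_) (edgeSum-sum w us (y ∷ xs))) (sym (sum-map-+ _ _ us))

  edgeSum-outside : ∀ {k} (q : A → Bool) (xs : Vec A (suc k)) →
                    anyL q (toList xs) ≡ false → edgeSum (λ x y → [ q x ∧ q y ]) xs ≡ 0
  edgeSum-outside q (x ∷ [])     _    = refl
  edgeSum-outside q (x ∷ y ∷ xs) none with q x
  ... | false = edgeSum-outside q (y ∷ xs) none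

data Ascending : ∀ {k} → Vec ℕ (suc k) → Set where
  start : ∀ a → Ascending (a ∷ [])
  up    : ∀ {k a} {hs : Vec ℕ (suc k)} → head hs ≡ suc a → Ascending hs → Ascending (a ∷ hs)

data Valley : ∀ {k} → Vec ℕ (suc k) → Set where
  rising : ∀ {k} {hs : Vec ℕ (suc k)} → Ascending hs → Valley hs
  down   : ∀ {k a} {hs : Vec ℕ (suc k)} → a ≡ suc (head hs) → Valley hs → Valley (a ∷ hs)

minimum : ∀ {k} → Vec ℕ (suc k) → ℕ
minimum = foldr₁ _⊓_

minimum≤head : ∀ {k} (hs : Vec ℕ (suc k)) → minimum hs ≤ head hs
minimum≤head (a ∷ [])     = ≤-refl
minimum≤head (a ∷ b ∷ hs) = m⊓n≤m a _

any≤ᵇ⇒minimum≤ : ∀ {A : Set} {k} (g : A → ℕ) F (xs : Vec A (suc k)) →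
                 anyL (λ x → g x ≤ᵇ F) (toList xs) ≡ true → minimum (vmap g xs) ≤ F
any≤ᵇ⇒minimum≤ g F (x ∷ xs) some with g x ≤ᵇ F | ≤ᵇ-reflects-≤ (g x) F
any≤ᵇ⇒minimum≤ g F (x ∷ [])     some | true  | ofʸ gx≤F = gx≤F
any≤ᵇ⇒minimum≤ g F (x ∷ y ∷ xs) some | true  | ofʸ gx≤F = ≤-trans (m⊓n≤m _ _) gx≤F
any≤ᵇ⇒minimum≤ g F (x ∷ y ∷ xs) some | false | ofⁿ _    =
  ≤-trans (m⊓n≤n _ _) (any≤ᵇ⇒minimum≤ g F (y ∷ xs) some)

lowEdges : ℕ → ∀ {k} → Vec ℕ (suc k) → ℕ
lowEdges F = edgeSum (λ a b → [ (a ≤ᵇ F) ∧ (b ≤ᵇ F) ])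

ascent-step : ∀ a F → [ suc a ≤ᵇ F ] + (F ∸ suc a) ≡ F ∸ a
ascent-step a F with suc a ≤ᵇ F | ≤ᵇ-reflects-≤ (suc a) F
... | true  | ofʸ a<F = sym (+-∸-assoc 1 a<F)
... | false | ofⁿ a≮F = trans (m≤n⇒m∸n≡0 (m≤n⇒m≤1+n F≤a)) (sym (m≤n⇒m∸n≡0 F≤a))
  where F≤a = ≤-pred (≰⇒> a≮F)

descent-step : ∀ {μ b} F → μ ≤ b → [ suc b ≤ᵇ F ] + (b ⊓ F ∸ μ) ≡ suc b ⊓ F ∸ μ
descent-step {μ} {b} F μ≤b with suc b ≤ᵇ F | ≤ᵇ-reflects-≤ (suc b) F
... | true  | ofʸ b<F = begin
  1 + (b ⊓ F ∸ μ)       ≡⟨ cong (λ m → 1 + (m ∸ μ)) (m≤n⇒m⊓n≡m (<⇒≤ b<F)) ⟩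
  1 + (b ∸ μ)           ≡⟨ sym (+-∸-assoc 1 μ≤b) ⟩
  suc b ∸ μ             ≡⟨ cong (_∸ μ) (sym (m≤n⇒m⊓n≡m b<F)) ⟩
  suc b ⊓ F ∸ μ         ∎
  where open ≡-Reasoning
... | false | ofⁿ b≮F = cong (_∸ μ) (trans (m≥n⇒m⊓n≡n F≤b) (sym (m≥n⇒m⊓n≡n (m≤n⇒m≤1+n F≤b))))
  where F≤b = ≤-pred (≰⇒> b≮F)

lowEdges-ascending : ∀ F {k a} {hs : Vec ℕ k} → Ascending (a ∷ hs) → lowEdges F (a ∷ hs) ≤ F ∸ a
lowEdges-ascending F (start a) = z≤n
lowEdges-ascending F {a = a} (up {hs = _ ∷ hs} refl asc) = begin
  [ (a ≤ᵇ F) ∧ (suc a ≤ᵇ F) ] + lowEdges F (suc a ∷ hs)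
    ≤⟨ +-mono-≤ ([a∧b]≤[b] (a ≤ᵇ F) _) (lowEdges-ascending F asc) ⟩
  [ suc a ≤ᵇ F ] + (F ∸ suc a)
    ≡⟨ ascent-step a F ⟩
  F ∸ a ∎
  where open ≤-Reasoning

-- The first summand counts the low edges of the descent, the second those of the ascent.
lowEdges-valley : ∀ F {k} {hs : Vec ℕ (suc k)} → Valley hs →
                  lowEdges F hs ≤ (head hs ⊓ F ∸ minimum hs) + (F ∸ minimum hs)
lowEdges-valley F {hs = a ∷ hs} (rising asc) =
  ≤-trans (lowEdges-ascending F asc) (≤-trans (∸-monoʳ-≤ F (minimum≤head (a ∷ hs))) (m≤n+m _ _))
lowEdges-valley F {hs = _ ∷ b ∷ hs} (down refl v) = begin
  [ (suc b ≤ᵇ F) ∧ (b ≤ᵇ F) ] + lowEdges F (b ∷ hs)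
    ≤⟨ +-mono-≤ ([a∧b]≤[a] (suc b ≤ᵇ F) _) (lowEdges-valley F v) ⟩
  [ suc b ≤ᵇ F ] + ((b ⊓ F ∸ μ) + (F ∸ μ))
    ≡⟨ sym (+-assoc [ suc b ≤ᵇ F ] _ _) ⟩
  [ suc b ≤ᵇ F ] + (b ⊓ F ∸ μ) + (F ∸ μ)
    ≡⟨ cong (_+ (F ∸ μ)) (descent-step F μ≤b) ⟩
  (suc b ⊓ F ∸ μ) + (F ∸ μ)
    ≡⟨ cong (λ ν → (suc b ⊓ F ∸ ν) + (F ∸ ν)) (sym (m≥n⇒m⊓n≡n (m≤n⇒m≤1+n μ≤b))) ⟩
  (suc b ⊓ F ∸ minimum (suc b ∷ b ∷ hs)) + (F ∸ minimum (suc b ∷ b ∷ hs)) ∎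
  where
  open ≤-Reasoning
  μ = minimum (b ∷ hs)
  μ≤b = minimum≤head (b ∷ hs)

lowEdges-valley≤ : ∀ F {k} {hs : Vec ℕ (suc k)} → Valley hs → lowEdges F hs ≤ 2 * (F ∸ minimum hs)
lowEdges-valley≤ F {hs = hs} v = begin
  lowEdges F hs                                        ≤⟨ lowEdges-valley F v ⟩
  (head hs ⊓ F ∸ minimum hs) + (F ∸ minimum hs)        ≤⟨ +-monoˡ-≤ _ (∸-monoˡ-≤ (minimum hs) (m⊓n≤n _ F)) ⟩
  (F ∸ minimum hs) + (F ∸ minimum hs)                  ≡⟨ cong (F ∸ minimum hs +_) (sym (+-identityʳ _)) ⟩
  2 * (F ∸ minimum hs)                                 ∎
  where open ≤-Reasoning

module Paths {n} (T : Graph n) where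

  adj-sym : ∀ {a b} → adj T a b ≡ true → adj T b a ≡ true
  adj-sym {a} {b} ab = trans (Graph.sym T b a) ab

  adj⇒≢ : ∀ {a b} → adj T a b ≡ true → a ≢ b
  adj⇒≢ {a} aa refl with trans (sym aa) (irrefl T a)
  ... | ()

  walk-snoc : ∀ {a b c k} → Walk T a b k → adj T b c ≡ true → Walk T a c (suc k)
  walk-snoc (stay a)   bc = step bc (stay _)
  walk-snoc (step e w) bc = step e (walk-snoc w bc)

  walk-reverse : ∀ {a b k} → Walk T a b k → Walk T b a k
  walk-reverse (stay a)   = stay a
  walk-reverse (step e w) = walk-snoc (walk-reverse w) (adj-sym e)

  dist-sym : ∀ {d : Fin n → Fin n → ℕ} → (∀ u v → IsDist T u v (d u v)) → ∀ u v → d u v ≡ d v u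
  dist-sym isDist u v = ≤-antisym (proj₂ (isDist u v) _ (walk-reverse (proj₁ (isDist v u))))
                                  (proj₂ (isDist v u) _ (walk-reverse (proj₁ (isDist u v))))

  infix 4 _≢head_
  _≢head_ : Fin n → ∀ {k} → Vec (Fin n) k → Set
  x ≢head []      = ⊤
  x ≢head (y ∷ _) = x ≢ y

  All≢⇒∉ : ∀ {k x} {R : Vec (Fin n) k} → All (x ≢_) R → ¬ x ∈ R
  All≢⇒∉ (x≢y ∷ _)  (here x≡y)  = x≢y x≡y
  All≢⇒∉ (_   ∷ ps) (there x∈R) = All≢⇒∉ ps x∈R

  ∉⇒All≢ : ∀ {k x} (R : Vec (Fin n) k) → ¬ x ∈ R → All (x ≢_) R
  ∉⇒All≢ []      _   = []
  ∉⇒All≢ (y ∷ R) x∉R = (λ x≡y → x∉R (here x≡y)) ∷ ∉⇒All≢ R (λ x∈R → x∉R (there x∈R))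

  path-prefix : ∀ {k} s (R : Vec (Fin n) k) {q} → IsPath T (s ∷ R) → q ∈ R →
    Σ ℕ λ j → Σ (Vec (Fin n) (suc j)) λ C →
      IsPath T (s ∷ C) × lookup C (fromℕ j) ≡ q × (∀ {P : Fin n → Set} → All P R → All P C)
  path-prefix s (x ∷ R) ((sx , _) , ((s≢x ∷ _) ∷ _)) (here q≡x) =
    0 , x ∷ [] , ((sx , tt) , ((s≢x ∷ []) ∷ ([] ∷ []))) , sym q≡x , λ { (p ∷ _) → p ∷ [] }
  path-prefix s (x ∷ R) ((sx , xR) , ((s≢x ∷ s∉R) ∷ uR)) (there q∈R)
    with path-prefix x R (xR , uR) q∈R
  ... | j , C , (xC , uC) , last≡q , sub =
    suc j , x ∷ C , ((sx , xC) , ((s≢x ∷ sub s∉R) ∷ uC)) , last≡q , λ { (p ∷ ps) → p ∷ sub ps }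

  module _ (acyclic : Acyclic T) where

    open import Data.Vec.Membership.DecPropositional (_≟ᶠ_ {n}) using (_∈?_)

    -- If x already occurred in R, the stretch of the path from y to that occurrence would close a cycle.
    path-∷ : ∀ {k x y} {R : Vec (Fin n) k} → IsPath T (y ∷ R) → adj T x y ≡ true → x ≢head R →
             IsPath T (x ∷ y ∷ R)
    path-∷ {R = []} _ xy _ = (xy , tt) , ((adj⇒≢ xy ∷ []) ∷ ([] ∷ []))
    path-∷ {x = x} {y} {R = z ∷ R} ((yz , zR) , ((y≢z ∷ y∉R) ∷ uR)) xy x≢z with x ∈? R
    ... | no x∉R = (xy , (yz , zR)) , ((adj⇒≢ xy ∷ x≢z ∷ ∉⇒All≢ R x∉R) ∷ ((y≢z ∷ y∉R) ∷ uR))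
    ... | yes x∈R with path-prefix z R (zR , uR) x∈R
    ...   | j , C , (zC , uC) , last≡x , sub =
      ⊥-elim (acyclic j (y ∷ z ∷ C)
        ( ((yz , zC) , ((y≢z ∷ sub y∉R) ∷ uC))
        , subst (λ w → adj T y w ≡ true) (sym last≡x) (adj-sym xy)))

module RootedTree {n} (T : Graph n) (acyclic : Acyclic T)
                  (d : Fin n → Fin n → ℕ) (isDist : ∀ u v → IsDist T u v (d u v))
                  (r : Fin n) where

  open Paths T

  depth : Fin n → ℕ
  depth u = d u r

  firstStep : ∀ {a k} → Walk T a r k → Fin n
  firstStep (stay _)           = r
  firstStep (step {v = v} _ _) = v

  firstStep-view : ∀ {a k} (w : Walk T a r k) →
    (k ≡ 0 × firstStep w ≡ a × a ≡ r) ⊎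
    (Σ ℕ λ k′ → k ≡ suc k′ × adj T a (firstStep w) ≡ true × Walk T (firstStep w) r k′)
  firstStep-view (stay _)   = inj₁ (refl , refl , refl)
  firstStep-view (step e w) = inj₂ (_ , refl , e , w)

  -- The root is its own parent.
  parent : Fin n → Fin n
  parent u = firstStep (proj₁ (isDist u r))

  depth≡0⇒root : ∀ {u} → depth u ≡ 0 → u ≡ r × parent u ≡ u
  depth≡0⇒root {u} u₀ with firstStep-view (proj₁ (isDist u r))
  ... | inj₁ (_ , parent≡u , u≡r) = u≡r , parent≡u
  ... | inj₂ (_ , u₊ , _) with trans (sym u₀) u₊
  ...   | ()

  depth≡suc⇒parent : ∀ {u k} → depth u ≡ suc k → adj T u (parent u) ≡ true × depth (parent u) ≡ k
  depth≡suc⇒parent {u} u₊ with firstStep-view (proj₁ (isDist u r))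
  ... | inj₁ (u₀ , _) with trans (sym u₊) u₀
  ...   | ()
  depth≡suc⇒parent {u} {k} u₊ | inj₂ (k′ , u₊′ , a , w) = a , ≤-antisym ≤k k≤
    where
    ≤k : depth (parent u) ≤ k
    ≤k = subst (depth (parent u) ≤_) (suc-injective (trans (sym u₊′) u₊)) (proj₂ (isDist (parent u) r) k′ w)
    k≤ : k ≤ depth (parent u)
    k≤ = ≤-pred (subst (_≤ suc (depth (parent u))) u₊
                       (proj₂ (isDist u r) _ (step a (proj₁ (isDist (parent u) r)))))

  depth-parent≤ : ∀ u → depth (parent u) ≤ depth u
  depth-parent≤ u = by-depth (depth u) refl
    where
    by-depth : ∀ t → depth u ≡ t → depth (parent u) ≤ depth u
    by-depth zero    u₀ = ≤-reflexive (cong depth (proj₂ (depth≡0⇒root u₀)))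
    by-depth (suc k) u₊ = ≤-trans (≤-reflexive (proj₂ (depth≡suc⇒parent u₊)))
                                  (≤-trans (n≤1+n k) (≤-reflexive (sym u₊)))

  parent-parent≢ : ∀ {u k} → depth u ≡ suc k → parent (parent u) ≢ u
  parent-parent≢ {u} {k} u₊ pp≡u = 1+n≰n (begin
    suc k                    ≡⟨ sym u₊ ⟩
    depth u                  ≡⟨ cong depth (sym pp≡u) ⟩
    depth (parent (parent u)) ≤⟨ depth-parent≤ (parent u) ⟩
    depth (parent u)         ≡⟨ proj₂ (depth≡suc⇒parent u₊) ⟩
    k                        ∎)
    where open ≤-Reasoning

  ancestors : ∀ t → Fin n → Vec (Fin n) t
  ancestors zero    u = []
  ancestors (suc t) u = parent u ∷ ancestors t (parent u)

  ≢head-ancestors : ∀ {x} t y → parent y ≢ x → x ≢head ancestors t y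
  ≢head-ancestors zero    y _          = tt
  ≢head-ancestors (suc t) y parent≢x x≡parent = parent≢x (sym x≡parent)

  ancestors-path : ∀ t u → depth u ≡ t → IsPath T (u ∷ ancestors t u) × r ∈ (u ∷ ancestors t u)
  ancestors-path zero    u u₀ = (tt , ([] ∷ [])) , here (sym (proj₁ (depth≡0⇒root u₀)))
  ancestors-path (suc t) u u₊ with depth≡suc⇒parent u₊
  ... | u~parent , parent-depth with ancestors-path t (parent u) parent-depth
  ...   | path , r∈ =
    path-∷ acyclic path u~parent (≢head-ancestors t (parent u) (parent-parent≢ u₊)) , there r∈

  -- Prepending parents keeps a path while the head's parent is not its successor; eventually the
  -- root is prepended a second time.
  climb-to-root : ∀ t {k} x (R : Vec (Fin n) k) → depth x ≡ t → IsPath T (x ∷ R) →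
                  parent x ≢head R → ¬ r ∈ R
  climb-to-root zero    x R x₀ (_ , (x∉R ∷ _)) _ r∈R with proj₁ (depth≡0⇒root x₀)
  ... | refl = All≢⇒∉ x∉R r∈R
  climb-to-root (suc t) x R x₊ path parent∉ r∈R with depth≡suc⇒parent x₊
  ... | x~parent , parent-depth =
    climb-to-root t (parent x) (x ∷ R) parent-depth (path-∷ acyclic path (adj-sym x~parent) parent∉)
                  (parent-parent≢ x₊) (there r∈R)

  parent-edge : ∀ {x y} → adj T x y ≡ true → parent x ≡ y ⊎ parent y ≡ x
  parent-edge {x} {y} xy with parent x ≟ᶠ y | parent y ≟ᶠ x
  ... | yes px≡y | _        = inj₁ px≡y
  ... | no _     | yes py≡x = inj₂ py≡x
  ... | no px≢y  | no py≢x  with ancestors-path (depth y) y refl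
  ...   | path , r∈ = ⊥-elim (climb-to-root (depth x) x (y ∷ ancestors (depth y) y) refl
                         (path-∷ acyclic path xy (≢head-ancestors (depth y) y py≢x)) px≢y r∈)

  parent≡⇒depth : ∀ {x y} → adj T x y ≡ true → parent x ≡ y → depth x ≡ suc (depth y)
  parent≡⇒depth {x} {y} xy px≡y = by-depth (depth x) refl
    where
    by-depth : ∀ t → depth x ≡ t → depth x ≡ suc (depth y)
    by-depth zero    x₀ = ⊥-elim (adj⇒≢ xy (trans (sym (proj₂ (depth≡0⇒root x₀))) px≡y))
    by-depth (suc k) x₊ = trans x₊ (cong suc (trans (sym (proj₂ (depth≡suc⇒parent x₊))) (cong depth px≡y)))

  adjacent-depths : ∀ {x y} → adj T x y ≡ true → depth x ≡ suc (depth y) ⊎ depth y ≡ suc (depth x)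
  adjacent-depths xy with parent-edge xy
  ... | inj₁ px≡y = inj₁ (parent≡⇒depth xy px≡y)
  ... | inj₂ py≡x = inj₂ (parent≡⇒depth (adj-sym xy) py≡x)

  -- Both neighbours of a peak would be its parent.
  no-peak : ∀ {x y z} → adj T x y ≡ true → adj T y z ≡ true → x ≢ z →
            depth y ≡ suc (depth x) → depth y ≢ suc (depth z)
  no-peak {x} {y} {z} xy yz x≢z y>x y>z with parent-edge xy | parent-edge yz
  ... | inj₁ px≡y | _        = n≢2+n (trans y>x (cong suc (parent≡⇒depth xy px≡y)))
  ... | inj₂ _    | inj₂ pz≡y = n≢2+n (trans y>z (cong suc (parent≡⇒depth (adj-sym yz) pz≡y)))
  ... | inj₂ py≡x | inj₁ py≡z = x≢z (trans (sym py≡x) py≡z)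

  depth-ascending : ∀ {k} x y (R : Vec (Fin n) k) → IsPath T (x ∷ y ∷ R) →
                    depth y ≡ suc (depth x) → Ascending (vmap depth (x ∷ y ∷ R))
  depth-ascending x y []      _ y>x = up y>x (start _)
  depth-ascending x y (z ∷ R) ((xy , yz , zR) , ((_ ∷ x≢z ∷ _) ∷ uR)) y>x with adjacent-depths yz
  ... | inj₁ y>z = ⊥-elim (no-peak xy yz x≢z y>x y>z)
  ... | inj₂ z>y = up y>x (depth-ascending y z R ((yz , zR) , uR) z>y)

  depth-valley : ∀ {k} (P : Vec (Fin n) (suc k)) → IsPath T P → Valley (vmap depth P)
  depth-valley (x ∷ [])     _ = rising (start _)
  depth-valley (x ∷ y ∷ R) path@((xy , yR) , (_ ∷ uR)) with adjacent-depths xy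
  ... | inj₁ x>y = down x>y (depth-valley (y ∷ R) (yR , uR))
  ... | inj₂ y>x = rising (depth-ascending x y R path y>x)

module BroadcastOnPath {n} (T : Graph n) (acyclic : Acyclic T)
                       (d : Fin n → Fin n → ℕ) (isDist : ∀ u v → IsDist T u v (d u v))
                       (f : Fin n → ℕ) {m} (P : Vec (Fin n) (suc m)) (path : IsPath T P) where

  open Paths T

  coversEdgeFrom : Fin n → Fin n → Fin n → Bool
  coversEdgeFrom u x y =
    inVf+ d f u ∧ inN d f u x ∧ inN d f u y ∧ (not (inB d f u x) ∨ not (inB d f u y))

  touchF touchD : Fin n → ℕ
  touchF u = if touch d f P u then f u else 0
  touchD u = if touch d f P u then distP d f P u else 0

  distP≡minimum : ∀ u → distP d f P u ≡ minimum (vmap (λ x → d x u) P)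
  distP≡minimum u = cong minimum (vmap-cong (λ x → dist-sym isDist u x) P)

  touchD≤touchF : ∀ u → touchD u ≤ touchF u
  touchD≤touchF u with inVf+ d f u
  ... | false = z≤n
  ... | true with anyL (inN d f u) (toList P) in touches
  ...   | false = z≤n
  ...   | true  = subst (_≤ f u) (sym (distP≡minimum u)) (any≤ᵇ⇒minimum≤ (λ x → d x u) (f u) P touches)

  edges-in-ball≤ : ∀ u → edgeSum (λ x y → [ inN d f u x ∧ inN d f u y ]) P
                         ≤ 2 * ((if anyL (inN d f u) (toList P) then f u else 0)
                                ∸ (if anyL (inN d f u) (toList P) then distP d f P u else 0))
  edges-in-ball≤ u with anyL (inN d f u) (toList P) in touches
  ... | false = ≤-reflexive (edgeSum-outside (inN d f u) P touches)
  ... | true  = begin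
    edgeSum (λ x y → [ inN d f u x ∧ inN d f u y ]) P   ≡⟨ sym (edgeSum-map _ depth P) ⟩
    lowEdges (f u) (vmap depth P)                       ≤⟨ lowEdges-valley≤ (f u) (depth-valley P path) ⟩
    2 * (f u ∸ minimum (vmap depth P))                  ≡⟨ cong (λ μ → 2 * (f u ∸ μ)) (sym (distP≡minimum u)) ⟩
    2 * (f u ∸ distP d f P u)                           ∎
    where
    open ≤-Reasoning
    open RootedTree T acyclic d isDist u using (depth; depth-valley)

  edges-covered-from≤ : ∀ u → edgeSum (λ x y → [ coversEdgeFrom u x y ]) P ≤ 2 * (touchF u ∸ touchD u)
  edges-covered-from≤ u with inVf+ d f u
  ... | false = ≤-reflexive (edgeSum-zero P)
  ... | true  = ≤-trans (edgeSum-mono P (λ x y → [a∧b∧c]≤[a∧b] (inN d f u x) (inN d f u y) _))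
                        (edges-in-ball≤ u)

  coveredEdges≤ : coveredEdges d f P ≤ 2 * (ΣTouch-f d f P ∸ σ₁ d f P)
  coveredEdges≤ = begin
    coveredEdges d f P                                  ≡⟨ count≡edgeSum (coversEdge d f) P ⟩
    edgeSum (λ x y → [ coversEdge d f x y ]) P
      ≤⟨ edgeSum-mono P (λ x y → [any]≤sum (λ u → coversEdgeFrom u x y) (allFin n)) ⟩
    edgeSum (λ x y → Σv (λ u → [ coversEdgeFrom u x y ])) P
      ≡⟨ edgeSum-sum (λ u x y → [ coversEdgeFrom u x y ]) (allFin n) P ⟩
    Σv (λ u → edgeSum (λ x y → [ coversEdgeFrom u x y ]) P)
      ≤⟨ sum-map-mono (allFin n) edges-covered-from≤ ⟩
    Σv (λ u → 2 * (touchF u ∸ touchD u))               ≡⟨ sum-map-*ˡ 2 _ (allFin n) ⟩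
    2 * Σv (λ u → touchF u ∸ touchD u)                  ≡⟨ cong (2 *_) (sum-map-∸ touchF touchD (allFin n) touchD≤touchF) ⟩
    2 * (ΣTouch-f d f P ∸ σ₁ d f P)                     ∎
    where open ≤-Reasoning

  σ-lower-bound : σ d f ≥ ⌈ coveredEdges d f P /2⌉ + σ₁ d f P + σ₂ d f P
  σ-lower-bound = begin
    ⌈ coveredEdges d f P /2⌉ + σ₁ d f P + σ₂ d f P
      ≤⟨ +-monoˡ-≤ (σ₂ d f P) (+-monoˡ-≤ (σ₁ d f P) (m≤2*n⇒⌈m/2⌉≤n coveredEdges≤)) ⟩
    ΣTouch-f d f P ∸ σ₁ d f P + σ₁ d f P + σ₂ d f P
      ≡⟨ cong (_+ σ₂ d f P) (m∸n+n≡m (sum-map-mono (allFin n) touchD≤touchF)) ⟩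
    ΣTouch-f d f P + σ₂ d f P
      ≡⟨ sym (sum-map-+ touchF _ (allFin n)) ⟩
    Σv (λ u → touchF u + (if off d f P u then f u else 0))
      ≤⟨ sum-map-mono (allFin n) (λ u → if-∧+if-∧-not≤ (inVf+ d f u) (anyL (inN d f u) (toList P)) (f u)) ⟩
    σ d f ∎
    where open ≤-Reasoning

lemma4p1 : ∀ {n} (T : Graph n) → IsTree T
    → (d : Fin n → Fin n → ℕ) → (∀ u v → IsDist T u v (d u v))
    → ∀ {m} (P : Vec (Fin n) (suc m)) → IsPath T P
    → (f : Fin n → ℕ) → IsBroadcast d f
    → (coveredEdges d f P ≤ 2 * (ΣTouch-f d f P ∸ σ₁ d f P))
    × (∀ b → coveredEdges d f P ≡ b → σ d f ≥ ⌈ b /2⌉ + σ₁ d f P + σ₂ d f P)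
lemma4p1 T (_ , acyclic) d isDist P path f _ = coveredEdges≤ , λ { _ refl → σ-lower-bound }
  where open BroadcastOnPath T acyclic d isDist f P path
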